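{- Let $G$ be a locally profinite group and $\mathcal{O}$ a discrete valuation ring with uniformizer $\varpi$, residue field $k$ and fraction field $K$. Let $\chi_1\neq\chi_2$ be characters $G\to\mathcal{O}^\times$ that are trivial modulo $\varpi$. Let $a$ be the largest integer such that $\chi_1\equiv\chi_2\pmod{\varpi^a}$, and let $\sigma(\chi_1,\chi_2)\in H^1(G,k)$ (with $G$ acting trivially on $k$) be the class of the homomorphism $g\mapsto \varpi^{ -a}(\chi_1(g)-\chi_2(g)) \bmod \varpi$. Let $L$ be a free $\mathcal{O}$-module with basis $e_1,e_2$, with $G$ acting by $ge_1=\chi_1(g)e_1$, $ge_2=\chi_2(g)e_2$, and let $L'$ be a $G$-stable $\mathcal O$-lattice in $L\otimes_{\mathcal O}K$, so that $L'/\varpi L'$ is an extension of $1_G$ by $1_G$. If $L'/\varpi L'$ is nonsplit, then $\sigma(\chi_1,\chi_2)$ generates the line in $H^1(G,k)$ corresponding to the extension $L'/\varpi L'$.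
   Context: $1_G$ is the trivial character of $G$ with values in $k$. Nonsplit extensions $E$ of $1_G$ by $1_G$ correspond bijectively to lines in $H^1(G,k)$ as follows: let $f_1$ span the $G$-invariant line of $E$ and complete it to a basis $f_1,f_2$; then $gf_2-f_2=\sigma_gf_1$ with $\sigma_g\in k$, and $g\mapsto\sigma_g$ is a nonzero class whose span (independent of choices) is the line attached to $E$. -}

module Defs where

open import Level using (0ℓ)
open import Algebra.Bundles using (Group; CommutativeRing)
open import Data.Nat using (ℕ; zero; suc)
open import Data.Product using (Σ; ∃; ∃₂; _×_; _,_; proj₁; proj₂)
open import Data.Unit using (⊤)
open import Data.Empty using (⊥)
open import Data.List using (List)
open import Data.List.Membership.Propositional using (_∈_)
open import Relation.Nullary using (¬_)
open import Relation.Unary using (Pred; _⊆_)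

module _ (G : Group 0ℓ 0ℓ) where
  open Group G

  record IsSubgroup (H : Pred Carrier 0ℓ) : Set where
    field
      H-resp : ∀ {x y} → x ≈ y → H x → H y
      H-ε    : H ε
      H-∙    : ∀ {x y} → H x → H y → H (x ∙ y)
      H-⁻¹   : ∀ {x} → H x → H (x ⁻¹)

  IsCompact : (Pred Carrier 0ℓ → Set) → Pred Carrier 0ℓ → Set₁
  IsCompact Open S =
    (I : Set) (U : I → Pred Carrier 0ℓ) → (∀ i → Open (U i)) →
    (∀ x → S x → ∃ λ i → U i x) →
    ∃ λ (is : List I) → ∀ x → S x → ∃ λ i → (i ∈ is) × U i x

  record LocallyProfinite : Set₁ where
    field
      Open      : Pred Carrier 0ℓ → Set
      open-resp : ∀ U → Open U → ∀ {x y} → x ≈ y → U x → U y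
      open-univ : Open (λ _ → ⊤)
      open-⋃    : (I : Set) (U : I → Pred Carrier 0ℓ) → (∀ i → Open (U i)) →
                  Open (λ x → ∃ λ i → U i x)
      open-∩    : ∀ U V → Open U → Open V → Open (λ x → U x × V x)
      mult-cont : ∀ U → Open U → ∀ x y → U (x ∙ y) →
                  ∃₂ λ V W → Open V × Open W × V x × W y ×
                    (∀ {v w} → V v → W w → U (v ∙ w))
      inv-cont  : ∀ U → Open U → Open (λ x → U (x ⁻¹))
      hausdorff : ∀ x y → ¬ (x ≈ y) →
                  ∃₂ λ V W → Open V × Open W × V x × W y × (∀ z → V z → W z → ⊥)
      compact-open-basis : ∀ U → Open U → U ε →
                  ∃ λ H → IsSubgroup H × Open H × IsCompact Open H × (H ⊆ U)

module _ (R : CommutativeRing 0ℓ 0ℓ) where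
  open CommutativeRing R

  pow : Carrier → ℕ → Carrier
  pow x zero    = 1#
  pow x (suc n) = x * pow x n

  sub : Carrier → Carrier → Carrier
  sub x y = x + (- y)

  IsUnit : Carrier → Set
  IsUnit u = ∃ λ v → u * v ≈ 1#

  Divides : Carrier → Carrier → Set
  Divides d x = ∃ λ z → x ≈ d * z

  Congr : Carrier → ℕ → Carrier → Carrier → Set
  Congr π n x y = Divides (pow π n) (sub x y)

  record IsDVR (ϖ : Carrier) : Set where
    field
      nontrivial : ¬ (1# ≈ 0#)
      domain     : ∀ x y → x * y ≈ 0# → ¬ (x ≈ 0#) → y ≈ 0#
      ϖ-nonzero  : ¬ (ϖ ≈ 0#)
      ϖ-nonunit  : ¬ IsUnit ϖ
      factor     : ∀ x → ¬ (x ≈ 0#) → ∃₂ λ u n → IsUnit u × x ≈ u * pow ϖ n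

record IsFractionField (O K : CommutativeRing 0ℓ 0ℓ)
       (ι : CommutativeRing.Carrier O → CommutativeRing.Carrier K) : Set where
  private
    module O = CommutativeRing O
    module K = CommutativeRing K
  field
    ι-cong : ∀ {x y} → x O.≈ y → ι x K.≈ ι y
    ι-+    : ∀ x y → ι (x O.+ y) K.≈ ι x K.+ ι y
    ι-*    : ∀ x y → ι (x O.* y) K.≈ ι x K.* ι y
    ι-1    : ι O.1# K.≈ K.1#
    ι-inj  : ∀ {x y} → ι x K.≈ ι y → x O.≈ y
    K-nontrivial : ¬ (K.1# K.≈ K.0#)
    K-field      : ∀ x → ¬ (x K.≈ K.0#) → ∃ λ y → x K.* y K.≈ K.1#
    K-fractions  : ∀ x → ∃₂ λ a b → ¬ (b O.≈ O.0#) × (x K.* ι b K.≈ ι a)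

module _ (G : Group 0ℓ 0ℓ) (top : LocallyProfinite G)
         (O : CommutativeRing 0ℓ 0ℓ) (ϖ : CommutativeRing.Carrier O) where
  private
    module G = Group G
    module O = CommutativeRing O
  open LocallyProfinite top

  -- a continuous homomorphism G → O^× (O^× with the ϖ-adic topology)
  record IsContinuousCharacter (χ : G.Carrier → O.Carrier) : Set where
    field
      χ-cong : ∀ {g h} → g G.≈ h → χ g O.≈ χ h
      χ-∙    : ∀ g h → χ (g G.∙ h) O.≈ χ g O.* χ h
      χ-ε    : χ G.ε O.≈ O.1#
      χ-unit : ∀ g → IsUnit O (χ g)
      χ-cont : ∀ n → Open (λ g → Congr O ϖ n (χ g) O.1#)

record Mat2 (A : Set) : Set where
  constructor mat
  field
    m₁₁ m₁₂ m₂₁ m₂₂ : A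

Vec2 : Set → Set
Vec2 A = A × A

module _ (R : CommutativeRing 0ℓ 0ℓ) where
  open CommutativeRing R

  det : Vec2 Carrier → Vec2 Carrier → Carrier
  det (x₁ , x₂) (y₁ , y₂) = sub R (x₁ * y₂) (x₂ * y₁)

  _·ᵥ_ : Mat2 Carrier → Vec2 Carrier → Vec2 Carrier
  mat a b c d ·ᵥ (x , y) = (a * x + b * y , c * x + d * y)

  scale : Carrier → Vec2 Carrier → Vec2 Carrier
  scale c (x , y) = (c * x , c * y)

  _+ᵥ_ : Vec2 Carrier → Vec2 Carrier → Vec2 Carrier
  (x , y) +ᵥ (x' , y') = (x + x' , y + y')

  _≈ᵥ_ : Vec2 Carrier → Vec2 Carrier → Set
  (x , y) ≈ᵥ (x' , y') = (x ≈ x') × (y ≈ y')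

module _ (O : CommutativeRing 0ℓ 0ℓ) (ϖ : CommutativeRing.Carrier O) where
  private module O = CommutativeRing O

  -- congruence of vectors of O² modulo ϖ (i.e. equality in k² = (O/ϖ)²)
  CongrV : Vec2 O.Carrier → Vec2 O.Carrier → Set
  CongrV (x , y) (x' , y') = Congr O ϖ 1 x x' × Congr O ϖ 1 y y'

  -- the reductions of f₁, f₂ form a basis of k²
  ResBasis : Vec2 O.Carrier → Vec2 O.Carrier → Set
  ResBasis f₁ f₂ = ¬ Divides O ϖ (det O f₁ f₂)

  Invariant : {G : Set} → (G → Mat2 O.Carrier) → Vec2 O.Carrier → Set
  Invariant M f = ∀ g → CongrV (_·ᵥ_ O (M g) f) f

  -- the extension k² (G acting through M mod ϖ) is split, i.e. isomorphic
  -- to 1_G ⊕ 1_G: it has a basis of G-invariant vectors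
  Split : {G : Set} → (G → Mat2 O.Carrier) → Set
  Split M = ∃₂ λ w₁ w₂ → ResBasis w₁ w₂ × Invariant M w₁ × Invariant M w₂

module _ (G : Group 0ℓ 0ℓ) (O K : CommutativeRing 0ℓ 0ℓ)
         (ι : CommutativeRing.Carrier O → CommutativeRing.Carrier K) where
  private
    module G = Group G
    module O = CommutativeRing O
    module K = CommutativeRing K

  actL : (χ₁ χ₂ : G.Carrier → O.Carrier) → G.Carrier → Vec2 K.Carrier → Vec2 K.Carrier
  actL χ₁ χ₂ g (x , y) = (ι (χ₁ g) K.* x , ι (χ₂ g) K.* y)

  -- M g is the matrix of g acting on the lattice L' = O v₁ ⊕ O v₂ in the
  -- basis v₁, v₂:  g vⱼ = Σᵢ (M g)ᵢⱼ vᵢ  (this expresses that L' is G-stable)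
  IsLatticeMatrix : (χ₁ χ₂ : G.Carrier → O.Carrier) (v₁ v₂ : Vec2 K.Carrier) →
                    (G.Carrier → Mat2 O.Carrier) → Set
  IsLatticeMatrix χ₁ χ₂ v₁ v₂ M = ∀ g →
    _≈ᵥ_ K (actL χ₁ χ₂ g v₁)
      (_+ᵥ_ K (scale K (ι (Mat2.m₁₁ (M g))) v₁) (scale K (ι (Mat2.m₂₁ (M g))) v₂)) ×
    _≈ᵥ_ K (actL χ₁ χ₂ g v₂)
      (_+ᵥ_ K (scale K (ι (Mat2.m₁₂ (M g))) v₁) (scale K (ι (Mat2.m₂₂ (M g))) v₂))

{-# OPTIONS --safe #-}
-- Let d(g) = det(g f₂, f₂), computed in the basis v₁, v₂ of L'. Computing the same
-- determinant in the eigenbasis e₁, e₂ of L ⊗ K gives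
--   det(v₁, v₂) · d(g) = (χ₁(g) − χ₂(g)) · u₁u₂ = ϖᵃ s(g) · u₁u₂,
-- where u₁, u₂ are the e-coordinates of f₂. So d and s are proportional over K, hence
-- b·d = a'·s over O with b ≠ 0. Neither d nor s is divisible by ϖ everywhere: for s this
-- is the maximality of a, for d it is nonsplitness, because d(g) ≡ τ(g) det(f₁, f₂) mod ϖ
-- with det(f₁, f₂) a unit. Comparing the valuations of a' and b then forces them to be
-- equal, so s = c·d with c a unit, and s ≡ c det(f₁, f₂) τ mod ϖ.
module Submission where

open import Defs
open import Level using (0ℓ)
open import Algebra.Bundles using (Group; CommutativeRing)
open import Data.Nat using (ℕ; suc)
open import Data.Product using (∃; _×_)
open import Relation.Nullary using (¬_)

open import Data.Nat as ℕ using (zero)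
import Data.Nat.Properties as ℕ
open import Data.Integer as ℤ using (ℤ; +_; -[1+_])
import Data.Integer.Properties as ℤ
open import Data.Sign as Sign using (Sign)
open import Data.Maybe using (Maybe; just; nothing)
open import Data.Product using (∃₂; _,_; proj₁; proj₂)
open import Data.Empty using (⊥-elim)
open import Function using (id)
open import Relation.Nullary using (yes; no)
import Relation.Binary.PropositionalEquality as ≡
import Algebra.Solver.Ring
import Algebra.Solver.Ring.AlmostCommutativeRing as ACR

-- The ring solver can only cancel coefficients whose arithmetic computes, so it is
-- instantiated with ℤ acting on R through its canonical ring map.
module IntegerCoefficientSolver (R : CommutativeRing 0ℓ 0ℓ) where
  open CommutativeRing R
  open import Algebra.Properties.Ring ring
    using (-0#≈0#; -‿involutive; -‿distribˡ-*; -‿distribʳ-*; -‿+-comm)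
  open import Algebra.Properties.Semiring.Mult semiring using (×-homo-+; ×1-homo-*)
    renaming (_×_ to _×ₙ_)
  open import Algebra.Properties.CommutativeSemigroup +-commutativeSemigroup using (interchange)
  open import Relation.Binary.Reasoning.Setoid setoid

  private
    ⟦_⟧ : ℤ → Carrier
    ⟦ + n ⟧      = n ×ₙ 1#
    ⟦ -[1+ n ] ⟧ = - (suc n ×ₙ 1#)

    ⊖-homo : ∀ m n → ⟦ m ℤ.⊖ n ⟧ ≈ m ×ₙ 1# - n ×ₙ 1#
    ⊖-homo zero    zero    = sym (trans (+-congˡ -0#≈0#) (+-identityʳ _))
    ⊖-homo zero    (suc n) = sym (+-identityˡ _)
    ⊖-homo (suc m) zero    = sym (trans (+-congˡ -0#≈0#) (+-identityʳ _))
    ⊖-homo (suc m) (suc n) rewrite ℤ.[1+m]⊖[1+n]≡m⊖n m n = begin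
      ⟦ m ℤ.⊖ n ⟧                        ≈⟨ ⊖-homo m n ⟩
      m ×ₙ 1# - n ×ₙ 1#                  ≈⟨ +-identityˡ _ ⟨
      0# + (m ×ₙ 1# - n ×ₙ 1#)           ≈⟨ +-congʳ (-‿inverseʳ 1#) ⟨
      (1# - 1#) + (m ×ₙ 1# - n ×ₙ 1#)    ≈⟨ interchange _ _ _ _ ⟩
      (1# + m ×ₙ 1#) + (- 1# - n ×ₙ 1#)  ≈⟨ +-congˡ (-‿+-comm _ _) ⟩
      (1# + m ×ₙ 1#) - (1# + n ×ₙ 1#)    ∎

    -‿homo : ∀ i → ⟦ ℤ.- i ⟧ ≈ - ⟦ i ⟧
    -‿homo (+ zero)  = sym -0#≈0#
    -‿homo (+ suc n) = refl
    -‿homo -[1+ n ]  = sym (-‿involutive _)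

    +-homo : ∀ i j → ⟦ i ℤ.+ j ⟧ ≈ ⟦ i ⟧ + ⟦ j ⟧
    +-homo -[1+ m ] -[1+ n ] = begin
      - (suc (suc (m ℕ.+ n)) ×ₙ 1#)  ≈⟨ -‿cong (reflexive (≡.cong (λ k → suc k ×ₙ 1#) (ℕ.+-suc m n))) ⟨
      - (suc m ℕ.+ suc n) ×ₙ 1#      ≈⟨ -‿cong (×-homo-+ 1# (suc m) (suc n)) ⟩
      - (suc m ×ₙ 1# + suc n ×ₙ 1#)  ≈⟨ -‿+-comm _ _ ⟨
      ⟦ -[1+ m ] ⟧ + ⟦ -[1+ n ] ⟧    ∎
    +-homo -[1+ m ] (+ n) = trans (⊖-homo n (suc m)) (+-comm _ _)
    +-homo (+ m) -[1+ n ] = ⊖-homo m (suc n)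
    +-homo (+ m) (+ n)    = ×-homo-+ 1# m n

    signed : Sign → Carrier → Carrier
    signed Sign.+ x = x
    signed Sign.- x = - x

    signed-cong : ∀ s {x y} → x ≈ y → signed s x ≈ signed s y
    signed-cong Sign.+ = id
    signed-cong Sign.- = -‿cong

    signed-* : ∀ s t x y → signed (s Sign.* t) (x * y) ≈ signed s x * signed t y
    signed-* Sign.+ Sign.+ x y = refl
    signed-* Sign.+ Sign.- x y = -‿distribʳ-* x y
    signed-* Sign.- Sign.+ x y = -‿distribˡ-* x y
    signed-* Sign.- Sign.- x y = begin
      x * y        ≈⟨ -‿involutive _ ⟨
      - - (x * y)  ≈⟨ -‿cong (-‿distribˡ-* x y) ⟩
      - (- x * y)  ≈⟨ -‿distribʳ-* (- x) y ⟩
      - x * - y    ∎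

    ◃-homo : ∀ s n → ⟦ s ℤ.◃ n ⟧ ≈ signed s (n ×ₙ 1#)
    ◃-homo Sign.- zero    = sym -0#≈0#
    ◃-homo Sign.- (suc n) = refl
    ◃-homo Sign.+ zero    = refl
    ◃-homo Sign.+ (suc n) = refl

    signed-abs : ∀ i → ⟦ i ⟧ ≈ signed (ℤ.sign i) (ℤ.∣ i ∣ ×ₙ 1#)
    signed-abs (+ n)    = refl
    signed-abs -[1+ n ] = refl

    *-homo : ∀ i j → ⟦ i ℤ.* j ⟧ ≈ ⟦ i ⟧ * ⟦ j ⟧
    *-homo i j = begin
      ⟦ i ℤ.* j ⟧                                  ≈⟨ ◃-homo (s Sign.* t) (m ℕ.* n) ⟩
      signed (s Sign.* t) ((m ℕ.* n) ×ₙ 1#)        ≈⟨ signed-cong (s Sign.* t) (×1-homo-* m n) ⟩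
      signed (s Sign.* t) ((m ×ₙ 1#) * (n ×ₙ 1#))  ≈⟨ signed-* s t (m ×ₙ 1#) (n ×ₙ 1#) ⟩
      signed s (m ×ₙ 1#) * signed t (n ×ₙ 1#)      ≈⟨ *-cong (signed-abs i) (signed-abs j) ⟨
      ⟦ i ⟧ * ⟦ j ⟧                                ∎
      where s = ℤ.sign i; t = ℤ.sign j; m = ℤ.∣ i ∣; n = ℤ.∣ j ∣

    ℤ⟶R : ACR._-Raw-AlmostCommutative⟶_ ℤ.+-*-rawRing (ACR.fromCommutativeRing R)
    ℤ⟶R = record
      { ⟦_⟧ = ⟦_⟧ ; +-homo = +-homo ; *-homo = *-homo ; -‿homo = -‿homo
      ; 0-homo = refl ; 1-homo = +-identityʳ 1# }

    ⟦⟧-≟ : ∀ i j → Maybe (⟦ i ⟧ ≈ ⟦ j ⟧)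
    ⟦⟧-≟ i j with i ℤ.≟ j
    ... | yes ≡.refl = just refl
    ... | no _       = nothing

  open Algebra.Solver.Ring ℤ.+-*-rawRing (ACR.fromCommutativeRing R) ℤ⟶R ⟦⟧-≟ public
    using (solve; _:=_; _:+_; _:-_; _:*_)

module CommutativeRingFacts (R : CommutativeRing 0ℓ 0ℓ) where
  open CommutativeRing R
  open IntegerCoefficientSolver R
  open import Relation.Binary.Reasoning.Setoid setoid

  pow-+ : ∀ π m n → pow R π (m ℕ.+ n) ≈ pow R π m * pow R π n
  pow-+ π zero    n = sym (*-identityˡ _)
  pow-+ π (suc m) n = trans (*-congˡ (pow-+ π m n)) (sym (*-assoc _ _ _))

  IsUnit-* : ∀ {x y} → IsUnit R x → IsUnit R y → IsUnit R (x * y)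
  IsUnit-* {x} {y} (x⁻¹ , xx⁻¹≈1) (y⁻¹ , yy⁻¹≈1) = x⁻¹ * y⁻¹ , (begin
    (x * y) * (x⁻¹ * y⁻¹)
      ≈⟨ solve 4 (λ x y x' y' → (x :* y) :* (x' :* y') := (x :* x') :* (y :* y')) refl x y x⁻¹ y⁻¹ ⟩
    (x * x⁻¹) * (y * y⁻¹) ≈⟨ *-cong xx⁻¹≈1 yy⁻¹≈1 ⟩
    1# * 1#               ≈⟨ *-identityʳ 1# ⟩
    1#                    ∎)

  unit-cancelˡ : ∀ {u u⁻¹ x y} → u * u⁻¹ ≈ 1# → u * x ≈ y → x ≈ u⁻¹ * y
  unit-cancelˡ {u} {u⁻¹} {x} {y} uu⁻¹≈1 ux≈y = begin
    x               ≈⟨ *-identityˡ x ⟨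
    1# * x          ≈⟨ *-congʳ uu⁻¹≈1 ⟨
    (u * u⁻¹) * x   ≈⟨ solve 3 (λ u u' x → (u :* u') :* x := u' :* (u :* x)) refl u u⁻¹ x ⟩
    u⁻¹ * (u * x)   ≈⟨ *-congˡ ux≈y ⟩
    u⁻¹ * y         ∎

  ∣-unit-cancelˡ : ∀ {π u x} → IsUnit R u → Divides R π (u * x) → Divides R π x
  ∣-unit-cancelˡ {π} {x = x} (u⁻¹ , uu⁻¹≈1) (z , ux≈πz) = u⁻¹ * z , (begin
    x              ≈⟨ unit-cancelˡ uu⁻¹≈1 ux≈πz ⟩
    u⁻¹ * (π * z)  ≈⟨ solve 3 (λ u' π z → u' :* (π :* z) := π :* (u' :* z)) refl u⁻¹ π z ⟩
    π * (u⁻¹ * z)  ∎)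

  ≈0⇒∣ : ∀ {π x} → x ≈ 0# → Divides R π x
  ≈0⇒∣ {π} x≈0 = 0# , trans x≈0 (sym (zeroʳ π))

  ∣⇒pow-suc-∣ : ∀ {π} n {x y} → x ≈ pow R π n * y → Divides R π y → Divides R (pow R π (suc n)) x
  ∣⇒pow-suc-∣ {π} n {x} {y} x≈πⁿy (z , y≈πz) = z , (begin
    x                      ≈⟨ x≈πⁿy ⟩
    pow R π n * y          ≈⟨ *-congˡ y≈πz ⟩
    pow R π n * (π * z)    ≈⟨ solve 3 (λ p π z → p :* (π :* z) := (π :* p) :* z) refl (pow R π n) π z ⟩
    (π * pow R π n) * z    ∎)

  ∣-resp : ∀ {π x y} → x ≈ y → Divides R π x → Divides R π y
  ∣-resp x≈y (z , x≈πz) = z , trans (sym x≈y) x≈πz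

  ∣-cancel-+-multiple : ∀ {π x e} → Divides R π (x + π * e) → Divides R π x
  ∣-cancel-+-multiple {π} {x} {e} (z , x+πe≈πz) = z - e , (begin
    x                    ≈⟨ solve 3 (λ π x e → x := (x :+ π :* e) :- π :* e) refl π x e ⟩
    (x + π * e) - π * e  ≈⟨ +-congʳ x+πe≈πz ⟩
    π * z - π * e        ≈⟨ solve 3 (λ π z e → π :* z :- π :* e := π :* (z :- e)) refl π z e ⟩
    π * (z - e)          ∎)

  -- Congr π 1 means divisibility by pow π 1 = π * 1#; these translate it to multiples of π.
  ≈⇒congr₁ : ∀ {π x y z} → x ≈ y + π * z → Congr R π 1 x y
  ≈⇒congr₁ {π} {x} {y} {z} x≈y+πz = z , (begin
    x - y                  ≈⟨ +-congʳ x≈y+πz ⟩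
    (y + π * z) - y        ≈⟨ solve 3 (λ π y z → (y :+ π :* z) :- y := π :* z) refl π y z ⟩
    π * z                  ≈⟨ *-congʳ (*-identityʳ π) ⟨
    (π * 1#) * z           ∎)

  congr₁⇒≈ : ∀ {π x y} → Congr R π 1 x y → ∃ λ z → x ≈ y + π * z
  congr₁⇒≈ {π} {x} {y} (z , x-y≈π1z) = z , (begin
    x                 ≈⟨ solve 2 (λ x y → x := y :+ (x :- y)) refl x y ⟩
    y + (x - y)       ≈⟨ +-congˡ x-y≈π1z ⟩
    y + (π * 1#) * z  ≈⟨ +-congˡ (*-congʳ (*-identityʳ π)) ⟩
    y + π * z         ∎)

  congrV⇒≈ᵥ : ∀ {π w w'} → CongrV R π w w' → ∃ λ z → _≈ᵥ_ R w (_+ᵥ_ R w' (scale R π z))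
  congrV⇒≈ᵥ (x≡x' , y≡y') =
    let z₁ , x≈ = congr₁⇒≈ x≡x'
        z₂ , y≈ = congr₁⇒≈ y≡y'
    in (z₁ , z₂) , x≈ , y≈

  ≈ᵥ⇒congrV : ∀ {π w w' z} → _≈ᵥ_ R w (_+ᵥ_ R w' (scale R π z)) → CongrV R π w w'
  ≈ᵥ⇒congrV (x≈ , y≈) = ≈⇒congr₁ x≈ , ≈⇒congr₁ y≈

module DiscreteValuationRing (O : CommutativeRing 0ℓ 0ℓ) (ϖ : CommutativeRing.Carrier O) (dvr : IsDVR O ϖ) where
  open CommutativeRing O
  open IsDVR dvr
  open IntegerCoefficientSolver O
  open CommutativeRingFacts O
  open import Relation.Binary.Reasoning.Setoid setoid

  ϖ^ : ℕ → Carrier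
  ϖ^ = pow O ϖ

  ϖ^n≉0 : ∀ n → ¬ ϖ^ n ≈ 0#
  ϖ^n≉0 zero    = nontrivial
  ϖ^n≉0 (suc n) ϖϖ^n≈0 = ϖ^n≉0 n (domain ϖ (ϖ^ n) ϖϖ^n≈0 ϖ-nonzero)

  ϖ^-cancelˡ : ∀ n {x y} → ϖ^ n * x ≈ ϖ^ n * y → x ≈ y
  ϖ^-cancelˡ n {x} {y} eq = x∙y⁻¹≈ε⇒x≈y x y (domain (ϖ^ n) (x - y) ϖ^n[x-y]≈0 (ϖ^n≉0 n))
    where
    open import Algebra.Properties.Group +-group using (x∙y⁻¹≈ε⇒x≈y)
    ϖ^n[x-y]≈0 : ϖ^ n * (x - y) ≈ 0#
    ϖ^n[x-y]≈0 = begin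
      ϖ^ n * (x - y)            ≈⟨ solve 3 (λ p x y → p :* (x :- y) := p :* x :- p :* y) refl (ϖ^ n) x y ⟩
      ϖ^ n * x - ϖ^ n * y       ≈⟨ +-congʳ eq ⟩
      ϖ^ n * y - ϖ^ n * y       ≈⟨ -‿inverseʳ _ ⟩
      0#                        ∎

  ∤⇒IsUnit : ∀ {x} → ¬ Divides O ϖ x → IsUnit O x
  ∤⇒IsUnit {x} ϖ∤x with factor x (λ x≈0 → ϖ∤x (≈0⇒∣ x≈0))
  ... | u , zero  , (u⁻¹ , uu⁻¹≈1) , x≈u1 = u⁻¹ , trans (*-congʳ (trans x≈u1 (*-identityʳ u))) uu⁻¹≈1
  ... | u , suc k , _ , x≈uϖϖᵏ = ⊥-elim (ϖ∤x (u * ϖ^ k , trans x≈uϖϖᵏ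
          (solve 3 (λ u ϖ p → u :* (ϖ :* p) := ϖ :* (u :* p)) refl u ϖ (ϖ^ k))))

  IsUnit⇒∤ : ∀ {x} → IsUnit O x → ¬ Divides O ϖ x
  IsUnit⇒∤ {x} (x⁻¹ , xx⁻¹≈1) (z , x≈ϖz) = ϖ-nonunit (z * x⁻¹ , (begin
    ϖ * (z * x⁻¹)  ≈⟨ *-assoc ϖ z x⁻¹ ⟨
    (ϖ * z) * x⁻¹  ≈⟨ *-congʳ x≈ϖz ⟨
    x * x⁻¹        ≈⟨ xx⁻¹≈1 ⟩
    1#             ∎))

  lower-valuation⇒∣ : ∀ m k {u w x y} → IsUnit O u →
    (u * ϖ^ m) * x ≈ (w * ϖ^ (suc (m ℕ.+ k))) * y → Divides O ϖ x
  lower-valuation⇒∣ m k {u} {w} {x} {y} u-unit eq =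
    ∣-unit-cancelˡ u-unit (w * ϖ^ k * y , ϖ^-cancelˡ m (begin
      ϖ^ m * (u * x)                ≈⟨ solve 3 (λ p u x → p :* (u :* x) := (u :* p) :* x) refl (ϖ^ m) u x ⟩
      (u * ϖ^ m) * x                ≈⟨ eq ⟩
      (w * (ϖ * ϖ^ (m ℕ.+ k))) * y  ≈⟨ *-congʳ (*-congˡ (*-congˡ (pow-+ ϖ m k))) ⟩
      (w * (ϖ * (ϖ^ m * ϖ^ k))) * y ≈⟨ solve 5 (λ w ϖ p q y → (w :* (ϖ :* (p :* q))) :* y := p :* (ϖ :* (w :* q :* y)))
                                          refl w ϖ (ϖ^ m) (ϖ^ k) y ⟩
      ϖ^ m * (ϖ * (w * ϖ^ k * y))   ∎))

  equal-valuation⇒multiple : ∀ m {u w w⁻¹ x y} → w * w⁻¹ ≈ 1# →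
    (u * ϖ^ m) * x ≈ (w * ϖ^ m) * y → y ≈ (w⁻¹ * u) * x
  equal-valuation⇒multiple m {u} {w} {w⁻¹} {x} {y} ww⁻¹≈1 eq = begin
    y               ≈⟨ unit-cancelˡ ww⁻¹≈1 (ϖ^-cancelˡ m ϖ^m[wy]≈ϖ^m[ux]) ⟩
    w⁻¹ * (u * x)   ≈⟨ *-assoc w⁻¹ u x ⟨
    (w⁻¹ * u) * x   ∎
    where
    ϖ^m[wy]≈ϖ^m[ux] : ϖ^ m * (w * y) ≈ ϖ^ m * (u * x)
    ϖ^m[wy]≈ϖ^m[ux] = begin
      ϖ^ m * (w * y)  ≈⟨ solve 3 (λ p w y → p :* (w :* y) := (w :* p) :* y) refl (ϖ^ m) w y ⟩
      (w * ϖ^ m) * y  ≈⟨ eq ⟨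
      (u * ϖ^ m) * x  ≈⟨ solve 3 (λ p u x → (u :* p) :* x := p :* (u :* x)) refl (ϖ^ m) u x ⟩
      ϖ^ m * (u * x)  ∎

  compare-valuations : {I : Set} (x y : I → Carrier) {u w : Carrier} (m n : ℕ) →
    IsUnit O u → IsUnit O w → (∀ i → (u * ϖ^ m) * x i ≈ (w * ϖ^ n) * y i) →
    ¬ (∀ i → Divides O ϖ (x i)) → ¬ (∀ i → Divides O ϖ (y i)) →
    ∃ λ c → IsUnit O c × (∀ i → y i ≈ c * x i)
  compare-valuations x y {u} {w} m n u-unit w-unit eq ϖ∤x ϖ∤y with ℕ.compare m n
  ... | ℕ.less m k    = ⊥-elim (ϖ∤x λ i → lower-valuation⇒∣ m k u-unit (eq i))
  ... | ℕ.greater n k = ⊥-elim (ϖ∤y λ i → lower-valuation⇒∣ n k w-unit (sym (eq i)))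
  ... | ℕ.equal m     =
    let w⁻¹ , ww⁻¹≈1 = w-unit
    in  w⁻¹ * u , IsUnit-* (w , trans (*-comm w⁻¹ w) ww⁻¹≈1) u-unit ,
        λ i → equal-valuation⇒multiple m ww⁻¹≈1 (eq i)

  proportional⇒unit-multiple : {I : Set} (x y : I → Carrier) {a b : Carrier} → ¬ b ≈ 0# →
    (∀ i → b * x i ≈ a * y i) → ¬ (∀ i → Divides O ϖ (x i)) → ¬ (∀ i → Divides O ϖ (y i)) →
    ∃ λ c → IsUnit O c × (∀ i → y i ≈ c * x i)
  proportional⇒unit-multiple x y {a} {b} b≉0 bx≈ay ϖ∤x ϖ∤y =
    let u , m , u-unit , b≈uϖ^m = factor b b≉0
        w , n , w-unit , a≈wϖ^n = factor a a≉0
    in  compare-valuations x y m n u-unit w-unit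
          (λ i → trans (*-congʳ (sym b≈uϖ^m)) (trans (bx≈ay i) (*-congʳ a≈wϖ^n))) ϖ∤x ϖ∤y
    where
    a≉0 : ¬ a ≈ 0#
    a≉0 a≈0 = ϖ∤x λ i → ≈0⇒∣ (domain b (x i) (trans (bx≈ay i) (trans (*-congʳ a≈0) (zeroˡ _))) b≉0)

module PlaneDeterminant (R : CommutativeRing 0ℓ 0ℓ) where
  open CommutativeRing R
  open IntegerCoefficientSolver R
  open import Relation.Binary.Reasoning.Setoid setoid

  combine : Vec2 Carrier → Vec2 Carrier → Vec2 Carrier → Vec2 Carrier
  combine v₁ v₂ (x , y) = _+ᵥ_ R (scale R x v₁) (scale R y v₂)

  diagonal : Carrier → Carrier → Vec2 Carrier → Vec2 Carrier
  diagonal c₁ c₂ (x , y) = (c₁ * x , c₂ * y)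

  det-cong : ∀ {w₁ w₁' w₂ w₂'} → _≈ᵥ_ R w₁ w₁' → _≈ᵥ_ R w₂ w₂' → det R w₁ w₂ ≈ det R w₁' w₂'
  det-cong (x₁≈ , y₁≈) (x₂≈ , y₂≈) = +-cong (*-cong x₁≈ y₂≈) (-‿cong (*-cong y₁≈ x₂≈))

  det-combine : ∀ v₁ v₂ w w' →
    det R v₁ v₂ * det R w w' ≈ det R (combine v₁ v₂ w) (combine v₁ v₂ w')
  det-combine (A , B) (C , E) (x , y) (x' , y') = solve 8
    (λ A B C E x y x' y' → (A :* E :- B :* C) :* (x :* y' :- y :* x')
                        := (x :* A :+ y :* C) :* (x' :* B :+ y' :* E) :- (x :* B :+ y :* E) :* (x' :* A :+ y' :* C))
    refl A B C E x y x' y'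

  det-diagonal : ∀ c₁ c₂ u → det R (diagonal c₁ c₂ u) u ≈ (c₁ - c₂) * (proj₁ u * proj₂ u)
  det-diagonal c₁ c₂ (u₁ , u₂) =
    solve 4 (λ c₁ c₂ u₁ u₂ → (c₁ :* u₁) :* u₂ :- (c₂ :* u₂) :* u₁ := (c₁ :- c₂) :* (u₁ :* u₂))
      refl c₁ c₂ u₁ u₂

  det-shear : ∀ τ π w f z →
    det R (_+ᵥ_ R (_+ᵥ_ R w (scale R τ f)) (scale R π z)) w ≈ τ * det R f w + π * det R z w
  det-shear τ π (x , y) (p , q) (z₁ , z₂) = solve 8
    (λ τ π x y p q z₁ z₂ → ((x :+ τ :* p) :+ π :* z₁) :* y :- ((y :+ τ :* q) :+ π :* z₂) :* x
                        := τ :* (p :* y :- q :* x) :+ π :* (z₁ :* y :- z₂ :* x))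
    refl τ π x y p q z₁ z₂

  -- g(x v₁ + y v₂) = x g v₁ + y g v₂, one coordinate at a time
  combine-·ᵥ : ∀ {a b c d c₁ c₂} v₁ v₂ w →
    _≈ᵥ_ R (diagonal c₁ c₂ v₁) (combine v₁ v₂ (a , c)) →
    _≈ᵥ_ R (diagonal c₁ c₂ v₂) (combine v₁ v₂ (b , d)) →
    _≈ᵥ_ R (combine v₁ v₂ (_·ᵥ_ R (mat a b c d) w)) (diagonal c₁ c₂ (combine v₁ v₂ w))
  combine-·ᵥ {a} {b} {c} {d} {c₁} {c₂} (A , B) (C , E) (x , y) (c₁A≈ , c₂B≈) (c₁C≈ , c₂E≈) =
    coordinate c₁ A C c₁A≈ c₁C≈ , coordinate c₂ B E c₂B≈ c₂E≈
    where
    coordinate : ∀ γ P Q → γ * P ≈ a * P + c * Q → γ * Q ≈ b * P + d * Q →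
                 (a * x + b * y) * P + (c * x + d * y) * Q ≈ γ * (x * P + y * Q)
    coordinate γ P Q γP≈ γQ≈ = begin
      (a * x + b * y) * P + (c * x + d * y) * Q
        ≈⟨ solve 8 (λ a b c d x y P Q → (a :* x :+ b :* y) :* P :+ (c :* x :+ d :* y) :* Q
                                     := x :* (a :* P :+ c :* Q) :+ y :* (b :* P :+ d :* Q)) refl a b c d x y P Q ⟩
      x * (a * P + c * Q) + y * (b * P + d * Q) ≈⟨ +-cong (*-congˡ γP≈) (*-congˡ γQ≈) ⟨
      x * (γ * P) + y * (γ * Q)
        ≈⟨ solve 5 (λ γ x y P Q → x :* (γ :* P) :+ y :* (γ :* Q) := γ :* (x :* P :+ y :* Q)) refl γ x y P Q ⟩
      γ * (x * P + y * Q) ∎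

  det-diagonal-action : ∀ {a b c d c₁ c₂} v₁ v₂ w →
    _≈ᵥ_ R (diagonal c₁ c₂ v₁) (combine v₁ v₂ (a , c)) →
    _≈ᵥ_ R (diagonal c₁ c₂ v₂) (combine v₁ v₂ (b , d)) →
    let u = combine v₁ v₂ w in
    det R v₁ v₂ * det R (_·ᵥ_ R (mat a b c d) w) w ≈ (c₁ - c₂) * (proj₁ u * proj₂ u)
  det-diagonal-action {a} {b} {c} {d} {c₁} {c₂} v₁ v₂ w v₁-eigen v₂-eigen = begin
    det R v₁ v₂ * det R (_·ᵥ_ R (mat a b c d) w) w ≈⟨ det-combine v₁ v₂ _ w ⟩
    det R (combine v₁ v₂ (_·ᵥ_ R (mat a b c d) w)) u
      ≈⟨ det-cong (combine-·ᵥ v₁ v₂ w v₁-eigen v₂-eigen) (refl , refl) ⟩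
    det R (diagonal c₁ c₂ u) u                     ≈⟨ det-diagonal c₁ c₂ u ⟩
    (c₁ - c₂) * (proj₁ u * proj₂ u)                ∎
    where u = combine v₁ v₂ w

module FractionField (O K : CommutativeRing 0ℓ 0ℓ) (ι : CommutativeRing.Carrier O → CommutativeRing.Carrier K)
                     (ff : IsFractionField O K ι) where
  private module O = CommutativeRing O
  open CommutativeRing K
  open IsFractionField ff
  open IntegerCoefficientSolver K
  open PlaneDeterminant K
  open import Algebra.Properties.Ring ring using (x+x≈x⇒x≈0; +-inverseˡ-unique)
  open import Relation.Binary.Reasoning.Setoid setoid

  ι-0 : ι O.0# ≈ 0#
  ι-0 = x+x≈x⇒x≈0 _ (trans (sym (ι-+ O.0# O.0#)) (ι-cong (O.+-identityʳ _)))

  ι-neg : ∀ x → ι (O.- x) ≈ - ι x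
  ι-neg x = +-inverseˡ-unique _ _ (trans (sym (ι-+ _ _)) (trans (ι-cong (O.-‿inverseˡ x)) ι-0))

  ι-sub : ∀ x y → ι (sub O x y) ≈ ι x - ι y
  ι-sub x y = trans (ι-+ _ _) (+-congˡ (ι-neg y))

  ιᵥ : Vec2 O.Carrier → Vec2 Carrier
  ιᵥ (x , y) = (ι x , ι y)

  ιₘ : Mat2 O.Carrier → Mat2 Carrier
  ιₘ (mat a b c d) = mat (ι a) (ι b) (ι c) (ι d)

  ι-det : ∀ w w' → ι (det O w w') ≈ det K (ιᵥ w) (ιᵥ w')
  ι-det (x , y) (x' , y') = trans (ι-sub _ _) (+-cong (ι-* x y') (-‿cong (ι-* y x')))

  ι-·ᵥ : ∀ N w → _≈ᵥ_ K (ιᵥ (_·ᵥ_ O N w)) (_·ᵥ_ K (ιₘ N) (ιᵥ w))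
  ι-·ᵥ (mat a b c d) (x , y) = ι-linear a x b y , ι-linear c x d y
    where
    ι-linear : ∀ p x q y → ι (p O.* x O.+ q O.* y) ≈ ι p * ι x + ι q * ι y
    ι-linear p x q y = trans (ι-+ _ _) (+-cong (ι-* p x) (ι-* q y))

  det-lattice-action : ∀ {c₁ c₂} v₁ v₂ (N : Mat2 O.Carrier) w →
    _≈ᵥ_ K (diagonal (ι c₁) (ι c₂) v₁) (combine v₁ v₂ (ι (Mat2.m₁₁ N) , ι (Mat2.m₂₁ N))) →
    _≈ᵥ_ K (diagonal (ι c₁) (ι c₂) v₂) (combine v₁ v₂ (ι (Mat2.m₁₂ N) , ι (Mat2.m₂₂ N))) →
    let u = combine v₁ v₂ (ιᵥ w) in
    det K v₁ v₂ * ι (det O (_·ᵥ_ O N w) w) ≈ ι (sub O c₁ c₂) * (proj₁ u * proj₂ u)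
  det-lattice-action {c₁} {c₂} v₁ v₂ N w v₁-eigen v₂-eigen = begin
    det K v₁ v₂ * ι (det O (_·ᵥ_ O N w) w)
      ≈⟨ *-congˡ (trans (ι-det _ w) (det-cong (ι-·ᵥ N w) (refl , refl))) ⟩
    det K v₁ v₂ * det K (_·ᵥ_ K (ιₘ N) (ιᵥ w)) (ιᵥ w)
      ≈⟨ det-diagonal-action v₁ v₂ (ιᵥ w) v₁-eigen v₂-eigen ⟩
    (ι c₁ - ι c₂) * (proj₁ u * proj₂ u)              ≈⟨ *-congʳ (ι-sub c₁ c₂) ⟨
    ι (sub O c₁ c₂) * (proj₁ u * proj₂ u)            ∎
    where u = combine v₁ v₂ (ιᵥ w)

  clear-denominators : {I : Set} (x y : I → O.Carrier) {Δ γ : Carrier} → ¬ Δ ≈ 0# →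
    (∀ i → Δ * ι (x i) ≈ γ * ι (y i)) →
    ∃₂ λ a b → ¬ b O.≈ O.0# × (∀ i → b O.* x i O.≈ a O.* y i)
  clear-denominators x y {Δ} {γ} Δ≉0 eq =
    let Δ⁻¹ , ΔΔ⁻¹≈1 = K-field Δ Δ≉0
        a , b , b≉0 , γΔ⁻¹b≈a = K-fractions (γ * Δ⁻¹)
    in  a , b , b≉0 , λ i → ι-inj (begin
      ι (b O.* x i)                ≈⟨ ι-* b (x i) ⟩
      ι b * ι (x i)                ≈⟨ *-congˡ (trans (sym (*-identityˡ _)) (*-congʳ (sym ΔΔ⁻¹≈1))) ⟩
      ι b * ((Δ * Δ⁻¹) * ι (x i))
        ≈⟨ solve 4 (λ b Δ Δ' x → b :* ((Δ :* Δ') :* x) := b :* (Δ' :* (Δ :* x)))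
                   refl (ι b) Δ Δ⁻¹ (ι (x i)) ⟩
      ι b * (Δ⁻¹ * (Δ * ι (x i)))  ≈⟨ *-congˡ (*-congˡ (eq i)) ⟩
      ι b * (Δ⁻¹ * (γ * ι (y i)))
        ≈⟨ solve 4 (λ b Δ' γ y → b :* (Δ' :* (γ :* y)) := ((γ :* Δ') :* b) :* y)
                   refl (ι b) Δ⁻¹ γ (ι (y i)) ⟩
      ((γ * Δ⁻¹) * ι b) * ι (y i)  ≈⟨ *-congʳ γΔ⁻¹b≈a ⟩
      ι a * ι (y i)                ≈⟨ ι-* a (y i) ⟨
      ι (a O.* y i)                ∎)

module Reduction (O : CommutativeRing 0ℓ 0ℓ) (ϖ : CommutativeRing.Carrier O) (dvr : IsDVR O ϖ) where
  open CommutativeRing O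
  open IntegerCoefficientSolver O
  open CommutativeRingFacts O
  open DiscreteValuationRing O ϖ dvr using (∤⇒IsUnit)
  open PlaneDeterminant O
  open import Relation.Binary.Reasoning.Setoid setoid

  det-extension : ∀ {N f₁ f₂ τ} → CongrV O ϖ (_·ᵥ_ O N f₂) (_+ᵥ_ O f₂ (scale O τ f₁)) →
    ∃ λ e → det O (_·ᵥ_ O N f₂) f₂ ≈ τ * det O f₁ f₂ + ϖ * e
  det-extension {f₁ = f₁} {f₂} {τ} Nf₂≡f₂+τf₁ =
    let z , Nf₂≈ = congrV⇒≈ᵥ Nf₂≡f₂+τf₁
    in  det O z f₂ , trans (det-cong Nf₂≈ (refl , refl)) (det-shear τ ϖ f₂ f₁ z)

  congrV-shear-∣ : ∀ {w w' f τ} → CongrV O ϖ w (_+ᵥ_ O w' (scale O τ f)) → Divides O ϖ τ → CongrV O ϖ w w'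
  congrV-shear-∣ {w' = w'} {f} {τ} w≡w'+τf (t , τ≈ϖt) =
    let (z₁ , z₂) , (x≈ , y≈) = congrV⇒≈ᵥ w≡w'+τf
    in  ≈ᵥ⇒congrV {z = (t * proj₁ f + z₁ , t * proj₂ f + z₂)}
          (trans x≈ (absorb (proj₁ w') (proj₁ f) z₁) , trans y≈ (absorb (proj₂ w') (proj₂ f) z₂))
    where
    absorb : ∀ x p z → (x + τ * p) + ϖ * z ≈ x + ϖ * (t * p + z)
    absorb x p z = begin
      (x + τ * p) + ϖ * z        ≈⟨ +-congʳ (+-congˡ (*-congʳ τ≈ϖt)) ⟩
      (x + (ϖ * t) * p) + ϖ * z  ≈⟨ solve 5 (λ x ϖ t p z → (x :+ (ϖ :* t) :* p) :+ ϖ :* z := x :+ ϖ :* (t :* p :+ z))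
                                      refl x ϖ t p z ⟩
      x + ϖ * (t * p + z)        ∎

  nonsplit⇒det-∤ : {G : Set} (M : G → Mat2 Carrier) (f₁ f₂ : Vec2 Carrier) (τ : G → Carrier) →
    ResBasis O ϖ f₁ f₂ → Invariant O ϖ M f₁ →
    (∀ g → CongrV O ϖ (_·ᵥ_ O (M g) f₂) (_+ᵥ_ O f₂ (scale O (τ g) f₁))) →
    ¬ Split O ϖ M → ¬ (∀ g → Divides O ϖ (det O (_·ᵥ_ O (M g) f₂) f₂))
  nonsplit⇒det-∤ M f₁ f₂ τ f-basis f₁-invariant f₂-extension nonsplit ϖ∣det =
    nonsplit (f₁ , f₂ , f-basis , f₁-invariant ,
              λ g → congrV-shear-∣ (f₂-extension g) (ϖ∣τ g))
    where
    ϖ∣τ : ∀ g → Divides O ϖ (τ g)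
    ϖ∣τ g =
      let e , det≈ = det-extension (f₂-extension g)
      in  ∣-unit-cancelˡ (∤⇒IsUnit f-basis)
            (∣-resp (*-comm (τ g) _) (∣-cancel-+-multiple (∣-resp det≈ (ϖ∣det g))))

proposition3p1 :
  (G : Group 0ℓ 0ℓ) (top : LocallyProfinite G) →
  (O : CommutativeRing 0ℓ 0ℓ) (ϖ : CommutativeRing.Carrier O) → IsDVR O ϖ →
  (K : CommutativeRing 0ℓ 0ℓ) (ι : CommutativeRing.Carrier O → CommutativeRing.Carrier K) →
  IsFractionField O K ι →
  (χ₁ χ₂ : Group.Carrier G → CommutativeRing.Carrier O) →
  IsContinuousCharacter G top O ϖ χ₁ → IsContinuousCharacter G top O ϖ χ₂ →
  ¬ (∀ g → CommutativeRing._≈_ O (χ₁ g) (χ₂ g)) →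
  (∀ g → Congr O ϖ 1 (χ₁ g) (CommutativeRing.1# O)) →
  (∀ g → Congr O ϖ 1 (χ₂ g) (CommutativeRing.1# O)) →
  (a : ℕ) → (∀ g → Congr O ϖ a (χ₁ g) (χ₂ g)) →
  ¬ (∀ g → Congr O ϖ (suc a) (χ₁ g) (χ₂ g)) →
  (s : Group.Carrier G → CommutativeRing.Carrier O) →
  (∀ g → CommutativeRing._≈_ O (sub O (χ₁ g) (χ₂ g))
                                (CommutativeRing._*_ O (pow O ϖ a) (s g))) →
  (v₁ v₂ : Vec2 (CommutativeRing.Carrier K)) →
  ¬ (CommutativeRing._≈_ K (det K v₁ v₂) (CommutativeRing.0# K)) →
  (M : Group.Carrier G → Mat2 (CommutativeRing.Carrier O)) →
  IsLatticeMatrix G O K ι χ₁ χ₂ v₁ v₂ M →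
  ¬ Split O ϖ M →
  (f₁ f₂ : Vec2 (CommutativeRing.Carrier O)) → ResBasis O ϖ f₁ f₂ →
  Invariant O ϖ M f₁ →
  (τ : Group.Carrier G → CommutativeRing.Carrier O) →
  (∀ g → CongrV O ϖ (_·ᵥ_ O (M g) f₂) (_+ᵥ_ O f₂ (scale O (τ g) f₁))) →
  ∃ λ c → ¬ Divides O ϖ c ×
    (∀ g → Congr O ϖ 1 (s g) (CommutativeRing._*_ O c (τ g)))
proposition3p1 G _ O ϖ dvr K ι ff χ₁ χ₂ _ _ _ _ _ a _ a-maximal s χ₁-χ₂≈ϖᵃs v₁ v₂ Δ≉0 M lattice nonsplit
               f₁ f₂ f-basis f₁-invariant τ f₂-extension =
  let a' , b , b≉0 , b·d≈a'·s = clear-denominators d s Δ≉0 Δ·d≈γ·s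
      c , c-unit , s≈c·d = proportional⇒unit-multiple d s b≉0 b·d≈a'·s
        (nonsplit⇒det-∤ M f₁ f₂ τ f-basis f₁-invariant f₂-extension nonsplit)
        (λ ϖ∣s → a-maximal λ g → ∣⇒pow-suc-∣ a (χ₁-χ₂≈ϖᵃs g) (ϖ∣s g))
  in  c * D , IsUnit⇒∤ (IsUnit-* c-unit (∤⇒IsUnit f-basis)) , λ g →
        let e , d≈τD+ϖe = det-extension (f₂-extension g)
        in  ≈⇒congr₁ (trans (s≈c·d g) (trans (*-congˡ d≈τD+ϖe)
              (solve 5 (λ c τ D ϖ e → c :* (τ :* D :+ ϖ :* e) := (c :* D) :* τ :+ ϖ :* (c :* e))
                       refl c (τ g) D ϖ e)))
  where
  module K = CommutativeRing K
  open CommutativeRing O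
  open IntegerCoefficientSolver O
  open CommutativeRingFacts O
  open DiscreteValuationRing O ϖ dvr
  open Reduction O ϖ dvr
  open FractionField O K ι ff
  open IsFractionField ff using (ι-cong; ι-*)
  open PlaneDeterminant K using (combine)
  open import Algebra.Properties.CommutativeSemigroup K.*-commutativeSemigroup using (xy∙z≈xz∙y)
  open import Relation.Binary.Reasoning.Setoid K.setoid

  d : Group.Carrier G → Carrier
  d g = det O (_·ᵥ_ O (M g) f₂) f₂

  D : Carrier
  D = det O f₁ f₂

  U : K.Carrier
  U = let u = combine v₁ v₂ (ιᵥ f₂) in proj₁ u K.* proj₂ u

  Δ·d≈γ·s : ∀ g → det K v₁ v₂ K.* ι (d g) K.≈ (ι (ϖ^ a) K.* U) K.* ι (s g)
  Δ·d≈γ·s g = begin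
    det K v₁ v₂ K.* ι (d g)       ≈⟨ det-lattice-action v₁ v₂ (M g) f₂ (proj₁ (lattice g)) (proj₂ (lattice g)) ⟩
    ι (sub O (χ₁ g) (χ₂ g)) K.* U ≈⟨ K.*-congʳ (K.trans (ι-cong (χ₁-χ₂≈ϖᵃs g)) (ι-* (ϖ^ a) (s g))) ⟩
    (ι (ϖ^ a) K.* ι (s g)) K.* U  ≈⟨ xy∙z≈xz∙y _ _ _ ⟩
    (ι (ϖ^ a) K.* U) K.* ι (s g)  ∎
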